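{- Let $f(n)=an^{2}+bn+c$ with $a,b,c\in\mathbb{Z}$, $a\neq 0$, and assume $a,b,c$ are not all even. Consider the sequence $(\nu_{2}(f(n)))_{n\geq 0}$. Then: \begin{enumerate} \item If $a$ and $b$ are even and $c$ is odd, then $\nu_{2}(f(n))=0$ for all $n\in\mathbb{N}$. \item If $a$ is even and $b$ is odd, then $(\nu_{2}(f(n)))_{n\geq 0}$ is unbounded. \item If $a$ is odd and $b$ is even, then: \begin{enumerate} \item if $b^{2}-4ac=0$, then $(\nu_{2}(f(n)))_{n\geq 0}$ is unbounded; \item if $b^{2}-4ac=4^{\ell}\Delta$ where $\ell$ is the largest positive integer with $4^{\ell}\mid b^2-4ac$ and $\Delta\equiv 1 \pmod 8$, then $(\nu_{2}(f(n)))_{n\geq 0}$ is unbounded; \item if $b^{2}-4ac=4^{\ell}\Delta$ where $\ell$ is the largest positive integer with $4^{\ell}\mid b^2-4ac$ and $\Delta\equiv m\pmod 8$ with $m\in\{2,3,5,6,7\}$, then $(\nu_{2}(f(n)))_{n\geq 0}$ is bounded and periodic with minimal period length exactly $2^{\ell}$. \end{enumerate} \item If $a$ and $b$ are odd and $c$ is even, then $(\nu_{2}(f(n)))_{n\geq 0}$ is unbounded. \item If $a$, $b$, $c$ are all odd, then $\nu_{2}(f(n))=0$ for all $n\in\mathbb{N}$. \end{enumerate}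
   Context: $\mathbb{N}=\{0,1,2,\ldots\}$. For an integer $x\neq 0$, $\nu_2(x)$ is the exponent of the highest power of $2$ dividing $x$, and $\nu_2(0)=+\infty$. -}

module Defs where

open import Data.Nat as ℕ using (ℕ; zero; suc)
open import Data.Nat.DivMod as ℕD using ()
open import Data.Integer as ℤ using (ℤ; +_; ∣_∣)
open import Data.Product using (∃; _×_)
open import Relation.Binary.PropositionalEquality using (_≡_; _≢_)
open import Relation.Nullary using (yes; no)

data ℕ∞ : Set where
  fin : ℕ → ℕ∞
  ∞   : ℕ∞

data _≤∞_ : ℕ∞ → ℕ∞ → Set where
  fin≤fin : ∀ {m n} → m ℕ.≤ n → fin m ≤∞ fin n
  _≤∞∞    : ∀ x → x ≤∞ ∞

-- number of factors 2 of m, with fuel k (fuel m suffices for m ≥ 1, as 2^v ≤ m)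
ν₂-fuel : ℕ → ℕ → ℕ
ν₂-fuel zero    m = 0
ν₂-fuel (suc k) m with m ℕD.% 2
... | zero  = suc (ν₂-fuel k (m ℕD./ 2))
... | suc _ = 0

ν₂ : ℤ → ℕ∞
ν₂ x with x ℤ.≟ + 0
... | yes _ = ∞
... | no  _ = fin (ν₂-fuel ∣ x ∣ ∣ x ∣)

quad : ℤ → ℤ → ℤ → ℕ → ℤ
quad a b c n = a ℤ.* (+ n ℤ.* + n) ℤ.+ b ℤ.* + n ℤ.+ c

Bounded : (ℕ → ℕ∞) → Set
Bounded s = ∃ λ B → ∀ n → s n ≤∞ fin B

Unbounded : (ℕ → ℕ∞) → Set
Unbounded s = ∀ B → ∃ λ n → fin B ≤∞ s n

IsPeriod : (ℕ → ℕ∞) → ℕ → Set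
IsPeriod s p = 0 ℕ.< p × (∀ n → s (n ℕ.+ p) ≡ s n)

MinimalPeriod : (ℕ → ℕ∞) → ℕ → Set
MinimalPeriod s p = IsPeriod s p × (∀ q → IsPeriod s q → p ℕ.≤ q)

-- If b is odd, f′(n) = 2an + b is odd, so an even value of f lifts by Hensel's lemma to roots
-- modulo every power of 2; if a ≡ b (mod 2) and c is odd, f only takes odd values.
-- If a is odd and b = 2β, completing the square gives a·f(n) = (an + β)² − D/4, and an + β runs
-- through every residue class modulo every power of 2. When D = 0 or Δ ≡ 1 (mod 8), D/4 is a square
-- modulo every power of 2, so ν₂(f(n)) is unbounded. Otherwise, with D = 4^(m+1)Δ, the valuation
-- of x² − 4^m Δ depends only on x mod 2^(m+1), is at most 2m + 2, and its value at x = 0 is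
-- attained only on the class of 0, which pins the minimal period down to 2^(m+1).
module Submission where

open import Defs
open import Data.Nat as ℕ using (ℕ; zero; suc; z≤n; s≤s)
import Data.Nat.Properties as ℕP
import Data.Nat.Divisibility as ℕD
open import Data.Nat.DivMod as ℕDM using ()
open import Data.Integer as ℤ using (ℤ; +_; _+_; _*_; _-_; -_; ∣_∣)
import Data.Integer.Properties as ℤP
open import Data.Integer.Divisibility using (_∣_)
open import Data.Integer.Divisibility.Signed using (divides; ∣⇒∣ᵤ; ∣ᵤ⇒∣; ∣-refl; ∣-trans; ∣m∣n⇒∣m+n; ∣m+n∣m⇒∣n; ∣m+n∣n⇒∣m; ∣m⇒∣m*n; ∣n⇒∣m*n; *-monoʳ-∣; *-cancelˡ-∣) renaming (_∣_ to _∣ˢ_)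
open import Data.Integer.DivMod using (_%_; _/_; a≡a%n+[a/n]*n; n%d<d)
open import Data.Integer.Tactic.RingSolver using (solve-∀)
open import Data.Product using (_×_; _,_; ∃; map₂)
open import Data.Sum using (_⊎_; inj₁; inj₂)
open import Data.Empty using (⊥-elim)
open import Function using (case_of_)
open import Relation.Nullary using (¬_; yes; no)
open import Relation.Binary.PropositionalEquality

2^_ : ℕ → ℤ
2^ k = + (2 ℕ.^ k)

2^-suc : ∀ k → 2^ suc k ≡ + 2 * 2^ k
2^-suc k = ℤP.pos-* 2 (2 ℕ.^ k)

2^-∣-2^ : ∀ {j k} → j ℕ.≤ k → 2^ j ∣ˢ 2^ k
2^-∣-2^ {j} j≤k with ℕP.m≤n⇒∃[o]m+o≡n j≤k
... | o , refl = ∣ᵤ⇒∣ (ℕD.divides (2 ℕ.^ o) (trans (ℕP.^-distribˡ-+-* 2 j o) (ℕP.*-comm (2 ℕ.^ j) (2 ℕ.^ o))))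

2^0∣ : ∀ z → 2^ 0 ∣ˢ z
2^0∣ z = divides z (sym (ℤP.*-identityʳ z))

2^∣⇒2^suc∣2* : ∀ k {z} → 2^ k ∣ˢ z → 2^ suc k ∣ˢ + 2 * z
2^∣⇒2^suc∣2* k d = subst (_∣ˢ _) (sym (2^-suc k)) (*-monoʳ-∣ (+ 2) d)

4^≡2^*2^ : ∀ m → + (4 ℕ.^ m) ≡ 2^ m * 2^ m
4^≡2^*2^ zero    = refl
4^≡2^*2^ (suc m) = begin
  + (4 ℕ.* 4 ℕ.^ m)                 ≡⟨ ℤP.pos-* 4 (4 ℕ.^ m) ⟩
  + 4 * + (4 ℕ.^ m)                 ≡⟨ cong (+ 4 *_) (4^≡2^*2^ m) ⟩
  + 4 * (2^ m * 2^ m)               ≡⟨ square-of-double (2^ m) ⟩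
  (+ 2 * 2^ m) * (+ 2 * 2^ m)       ≡⟨ sym (cong₂ _*_ (2^-suc m) (2^-suc m)) ⟩
  2^ suc m * 2^ suc m               ∎
  where
  open ≡-Reasoning
  square-of-double : ∀ x → + 4 * (x * x) ≡ (+ 2 * x) * (+ 2 * x)
  square-of-double = solve-∀

Even Odd : ℤ → Set
Even x = ∃ λ k → x ≡ + 2 * k
Odd  x = ∃ λ k → x ≡ + 2 * k + + 1

parity : ∀ x → Even x ⊎ Odd x
parity x with x % + 2 | n%d<d x (+ 2) | a≡a%n+[a/n]*n x (+ 2)
... | 0 | _ | x≡ = inj₁ (x / + 2 , trans x≡ (swap (x / + 2)))
  where
  swap : ∀ q → + 0 + q * + 2 ≡ + 2 * q
  swap = solve-∀
... | 1 | _ | x≡ = inj₂ (x / + 2 , trans x≡ (swap (x / + 2)))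
  where
  swap : ∀ q → + 1 + q * + 2 ≡ + 2 * q + + 1
  swap = solve-∀
... | suc (suc _) | s≤s (s≤s ()) | _

even⇒2∣ : ∀ {x} → Even x → + 2 ∣ˢ x
even⇒2∣ (k , x≡) = divides k (trans x≡ (ℤP.*-comm (+ 2) k))

odd⇒2∤ : ∀ {x} → Odd x → ¬ (+ 2 ∣ˢ x)
odd⇒2∤ (k , refl) 2∣x = case ℕD.∣1⇒≡1 (∣⇒∣ᵤ (∣m+n∣m⇒∣n 2∣x (even⇒2∣ (k , refl)))) of λ ()

2∣⇒even : ∀ x → + 2 ∣ x → Even x
2∣⇒even _ 2∣x with ∣ᵤ⇒∣ 2∣x
... | divides q x≡ = q , trans x≡ (ℤP.*-comm q (+ 2))

2∤⇒odd : ∀ x → ¬ (+ 2 ∣ x) → Odd x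
2∤⇒odd x 2∤x with parity x
... | inj₁ even = ⊥-elim (2∤x (∣⇒∣ᵤ (even⇒2∣ even)))
... | inj₂ odd = odd

even-+-even : ∀ {x y} → Even x → Even y → Even (x + y)
even-+-even (j , refl) (k , refl) = j + k , sym (ℤP.*-distribˡ-+ (+ 2) j k)

odd-+-odd : ∀ {x y} → Odd x → Odd y → Even (x + y)
odd-+-odd (j , refl) (k , refl) = j + k + + 1 , identity j k
  where
  identity : ∀ j k → + 2 * j + + 1 + (+ 2 * k + + 1) ≡ + 2 * (j + k + + 1)
  identity = solve-∀

odd-*-odd : ∀ {x y} → Odd x → Odd y → Odd (x * y)
odd-*-odd (j , refl) (k , refl) = + 2 * j * k + j + k , identity j k
  where
  identity : ∀ j k → (+ 2 * j + + 1) * (+ 2 * k + + 1) ≡ + 2 * (+ 2 * j * k + j + k) + + 1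
  identity = solve-∀

even-pronic : ∀ x → Even (x * (x + + 1))
even-pronic x with parity x
... | inj₁ (k , refl) = k * (+ 2 * k + + 1) , identity k
  where
  identity : ∀ k → + 2 * k * (+ 2 * k + + 1) ≡ + 2 * (k * (+ 2 * k + + 1))
  identity = solve-∀
... | inj₂ (k , refl) = (+ 2 * k + + 1) * (k + + 1) , identity k
  where
  identity : ∀ k → (+ 2 * k + + 1) * (+ 2 * k + + 1 + + 1) ≡ + 2 * ((+ 2 * k + + 1) * (k + + 1))
  identity = solve-∀

odd-square : ∀ k → ∃ λ T → (+ 2 * k + + 1) * (+ 2 * k + + 1) ≡ + 1 + + 8 * T
odd-square k with even-pronic k
... | T , k[k+1]≡2T = T , (begin
  (+ 2 * k + + 1) * (+ 2 * k + + 1) ≡⟨ expand k ⟩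
  + 1 + + 4 * (k * (k + + 1))       ≡⟨ cong (λ P → + 1 + + 4 * P) k[k+1]≡2T ⟩
  + 1 + + 4 * (+ 2 * T)             ≡⟨ cong (_+_ (+ 1)) (sym (ℤP.*-assoc (+ 4) (+ 2) T)) ⟩
  + 1 + + 8 * T                     ∎)
  where
  open ≡-Reasoning
  expand : ∀ k → (+ 2 * k + + 1) * (+ 2 * k + + 1) ≡ + 1 + + 4 * (k * (k + + 1))
  expand = solve-∀

-- Exact powers of 2 and the 2-adic valuation

infix 4 2^_∥_

record 2^_∥_ (v : ℕ) (z : ℤ) : Set where
  constructor exact
  field
    2^∣z     : 2^ v ∣ˢ z
    2^suc∤z  : ¬ (2^ suc v ∣ˢ z)

∥-intro : ∀ {v z} w → z ≡ 2^ v * (+ 2 * w + + 1) → 2^ v ∥ z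
∥-intro {v} w refl = exact (∣m⇒∣m*n _ ∣-refl) 2^suc∤
  where
  2^suc∤ : ¬ (2^ suc v ∣ˢ 2^ v * (+ 2 * w + + 1))
  2^suc∤ d = odd⇒2∤ (w , refl) (*-cancelˡ-∣ (2^ v) {{ℕP.m^n≢0 2 v}}
    (subst (_∣ˢ 2^ v * (+ 2 * w + + 1)) (trans (2^-suc v) (ℤP.*-comm (+ 2) (2^ v))) d))

odd⇒2^0∥ : ∀ {z} → Odd z → 2^ 0 ∥ z
odd⇒2^0∥ (w , z≡) = ∥-intro w (trans z≡ (sym (ℤP.*-identityˡ _)))

∥-2* : ∀ {v z} → 2^ v ∥ z → 2^ suc v ∥ + 2 * z
∥-2* {v} {z} (exact d nd) = exact (2^∣⇒2^suc∣2* v d)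
  (λ d′ → nd (*-cancelˡ-∣ (+ 2) (subst (_∣ˢ + 2 * z) (2^-suc (suc v)) d′)))

∥-+-2^* : ∀ {u v z} t → v ℕ.< u → 2^ v ∥ z → 2^ v ∥ z + 2^ u * t
∥-+-2^* t v<u (exact d nd) = exact
  (∣m∣n⇒∣m+n d (∣m⇒∣m*n t (2^-∣-2^ (ℕP.<⇒≤ v<u))))
  (λ d′ → nd (∣m+n∣n⇒∣m d′ (∣m⇒∣m*n t (2^-∣-2^ v<u))))

2^∣-cancel-odd : ∀ {a} → Odd a → ∀ k {z} → 2^ k ∣ˢ a * z → 2^ k ∣ˢ z
2^∣-cancel-odd oa zero    {z} _ = 2^0∣ z
2^∣-cancel-odd {a} oa (suc k) {z} d with parity z
... | inj₂ oz       = ⊥-elim (odd⇒2∤ (odd-*-odd oa oz) (∣-trans (2^-∣-2^ {1} {suc k} (s≤s z≤n)) d))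
... | inj₁ (j , refl) = 2^∣⇒2^suc∣2* k (2^∣-cancel-odd oa k (*-cancelˡ-∣ (+ 2)
        (subst₂ _∣ˢ_ (2^-suc k) (swap a j) d)))
  where
  swap : ∀ a j → a * (+ 2 * j) ≡ + 2 * (a * j)
  swap = solve-∀

∥-cancel-odd : ∀ {a v z} → Odd a → 2^ v ∥ a * z → 2^ v ∥ z
∥-cancel-odd {a} {v} oa (exact d nd) = exact (2^∣-cancel-odd oa v d) (λ d′ → nd (∣n⇒∣m*n a d′))

n<2^n : ∀ n → n ℕ.< 2 ℕ.^ n
n<2^n zero    = s≤s z≤n
n<2^n (suc n) = ℕP.+-mono-≤ (ℕP.m^n>0 2 n) (subst (n ℕ.<_) (sym (ℕP.+-identityʳ _)) (n<2^n n))

ν₂-fuel-≥ : ∀ B k m → 2 ℕ.^ B ℕD.∣ m → B ℕ.≤ k → B ℕ.≤ ν₂-fuel k m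
ν₂-fuel-≥ zero    k       m _ _ = z≤n
ν₂-fuel-≥ (suc B) (suc k) m d (s≤s B≤k) with m ℕDM.% 2 | ℕD.n∣m⇒m%n≡0 m 2 (ℕD.∣-trans (ℕD.m∣m*n (2 ℕ.^ B)) d)
... | zero  | _ = s≤s (ν₂-fuel-≥ B k (m ℕDM./ 2) (ℕD.m*n∣o⇒n∣o/m 2 (2 ℕ.^ B) d) B≤k)
... | suc _ | ()

ν₂-fuel-≡ : ∀ v k m → 2 ℕ.^ v ℕD.∣ m → ¬ (2 ℕ.^ suc v ℕD.∣ m) → v ℕ.< k → ν₂-fuel k m ≡ v
ν₂-fuel-≡ zero (suc k) m _ nd _ with m ℕDM.% 2 in m%2≡
... | zero  = ⊥-elim (nd (ℕD.m%n≡0⇒n∣m m 2 m%2≡))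
... | suc _ = refl
ν₂-fuel-≡ (suc v) (suc k) m d nd (s≤s v<k) with m ℕDM.% 2 | ℕD.n∣m⇒m%n≡0 m 2 (ℕD.∣-trans (ℕD.m∣m*n (2 ℕ.^ v)) d)
... | zero  | _ = cong suc (ν₂-fuel-≡ v k (m ℕDM./ 2) (ℕD.m*n∣o⇒n∣o/m 2 (2 ℕ.^ v) d)
        (λ d′ → nd (ℕD.m∣n/o⇒o*m∣n (ℕD.∣-trans (ℕD.m∣m*n (2 ℕ.^ v)) d) d′)) v<k)
... | suc _ | ()

exponent<∣z∣ : ∀ {B z} → z ≢ + 0 → 2^ B ∣ˢ z → B ℕ.< ∣ z ∣
exponent<∣z∣ {B} {z} z≢0 d = ℕP.<-≤-trans (n<2^n B)
  (ℕD.∣⇒≤ {{ℕ.≢-nonZero (λ ∣z∣≡0 → z≢0 (ℤP.∣i∣≡0⇒i≡0 ∣z∣≡0))}} (∣⇒∣ᵤ d))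

ν₂-≥ : ∀ {B z} → 2^ B ∣ˢ z → fin B ≤∞ ν₂ z
ν₂-≥ {B} {z} d with z ℤ.≟ + 0
... | yes _   = fin B ≤∞∞
... | no z≢0 = fin≤fin (ν₂-fuel-≥ B ∣ z ∣ ∣ z ∣ (∣⇒∣ᵤ d) (ℕP.<⇒≤ (exponent<∣z∣ z≢0 d)))

ν₂-≡ : ∀ {v z} → 2^ v ∥ z → ν₂ z ≡ fin v
ν₂-≡ {v} {z} (exact d nd) with z ℤ.≟ + 0
... | yes refl = ⊥-elim (nd (divides (+ 0) refl))
... | no z≢0  = cong fin (ν₂-fuel-≡ v ∣ z ∣ ∣ z ∣ (∣⇒∣ᵤ d) (λ d′ → nd (∣ᵤ⇒∣ d′)) (exponent<∣z∣ z≢0 d))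

fin-injective : ∀ {m n} → fin m ≡ fin n → m ≡ n
fin-injective refl = refl

∥-unique : ∀ {v w z} → 2^ v ∥ z → 2^ w ∥ z → v ≡ w
∥-unique v∥z w∥z = fin-injective (trans (sym (ν₂-≡ v∥z)) (ν₂-≡ w∥z))

unbounded : (g : ℕ → ℤ) → (∀ K → ∃ λ n → 2^ K ∣ˢ g n) → Unbounded (λ n → ν₂ (g n))
unbounded g roots K = map₂ ν₂-≥ (roots K)

-- Roots modulo powers of 2

2^suc∣ : ∀ k {z} q → z ≡ q * (+ 2 * 2^ k) → 2^ suc k ∣ˢ z
2^suc∣ k q z≡ = divides q (trans z≡ (cong (q *_) (sym (2^-suc k))))

2^-lift : ∀ k {z u} → Odd u → 2^ k ∣ˢ z → 2^ suc k ∣ˢ z ⊎ 2^ suc k ∣ˢ z + 2^ k * u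
2^-lift k (w , refl) (divides t refl) with parity t
... | inj₁ (t′ , refl) = inj₁ (2^suc∣ k t′ (identity t′ (2^ k)))
  where
  identity : ∀ t P → + 2 * t * P ≡ t * (+ 2 * P)
  identity = solve-∀
... | inj₂ (t′ , refl) = inj₂ (2^suc∣ k (t′ + w + + 1) (identity t′ w (2^ k)))
  where
  identity : ∀ t w P → (+ 2 * t + + 1) * P + P * (+ 2 * w + + 1) ≡ (t + w + + 1) * (+ 2 * P)
  identity = solve-∀

linear-roots-mod-2^ : ∀ a r → Odd a → ∀ K → ∃ λ n → 2^ K ∣ˢ a * + n + r
linear-roots-mod-2^ a r _ zero = 0 , 2^0∣ _
linear-roots-mod-2^ a r oa (suc K) with linear-roots-mod-2^ a r oa K
... | n , d with 2^-lift K oa d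
...   | inj₁ d′ = n , d′
...   | inj₂ d′ = n ℕ.+ 2 ℕ.^ K , subst (2^ suc K ∣ˢ_) (sym shift) d′
  where
  shift : a * + (n ℕ.+ 2 ℕ.^ K) + r ≡ a * + n + r + 2^ K * a
  shift = trans (cong (λ N → a * N + r) (ℤP.pos-+ n (2 ℕ.^ K))) (identity a (+ n) (2^ K) r)
    where
    identity : ∀ a N P r → a * (N + P) + r ≡ a * N + r + P * a
    identity = solve-∀

quad-shift : ∀ a b c n p → quad a b c (n ℕ.+ p) ≡ quad a b c n + + p * (+ 2 * a * + n + b + a * + p)
quad-shift a b c n p = trans (cong (λ N → a * (N * N) + b * N + c) (ℤP.pos-+ n p)) (identity a b c (+ n) (+ p))
  where
  identity : ∀ a b c N P → a * ((N + P) * (N + P)) + b * (N + P) + c ≡ a * (N * N) + b * N + c + P * (+ 2 * a * N + b + a * P)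
  identity = solve-∀

-- With b odd, the derivative 2an + b is odd, so a root mod 2^(K+1) lifts (Hensel).
quad-root-lift : ∀ a b c K n → Odd b → 2^ suc K ∣ˢ quad a b c n → ∃ λ n′ → 2^ suc (suc K) ∣ˢ quad a b c n′
quad-root-lift a b c K n (β , refl) d with 2^-lift (suc K) derivative-odd d
  where
  derivative-odd : Odd (+ 2 * a * + n + b + a * 2^ suc K)
  derivative-odd = a * + n + β + a * 2^ K ,
    trans (cong (λ P → + 2 * a * + n + b + a * P) (2^-suc K)) (identity a (+ n) β (2^ K))
    where
    identity : ∀ a N β P → + 2 * a * N + (+ 2 * β + + 1) + a * (+ 2 * P) ≡ + 2 * (a * N + β + a * P) + + 1
    identity = solve-∀
... | inj₁ d′ = n , d′
... | inj₂ d′ = n ℕ.+ 2 ℕ.^ suc K , subst (2^ suc (suc K) ∣ˢ_) (sym (quad-shift a b c n (2 ℕ.^ suc K))) d′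

quad-roots-mod-2^ : ∀ a b c n₀ → Odd b → + 2 ∣ˢ quad a b c n₀ → ∀ K → ∃ λ n → 2^ K ∣ˢ quad a b c n
quad-roots-mod-2^ a b c n₀ _  _ zero    = n₀ , 2^0∣ _
quad-roots-mod-2^ a b c n₀ ob d (suc K) = roots K
  where
  roots : ∀ K → ∃ λ n → 2^ suc K ∣ˢ quad a b c n
  roots zero    = n₀ , d
  roots (suc K) = let n , d′ = roots K in quad-root-lift a b c K n ob d′

odd-+-2^suc : ∀ {y} → Odd y → ∀ k → Odd (y + 2^ suc k)
odd-+-2^suc (z , refl) k = z + 2^ k , trans (cong (_+_ (+ 2 * z + + 1)) (2^-suc k)) (identity z (2^ k))
  where
  identity : ∀ z P → + 2 * z + + 1 + + 2 * P ≡ + 2 * (z + P) + + 1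
  identity = solve-∀

-- Replacing y by y + 2^(K+2) adds 2^(K+3)·(y + 2^(K+1)), an odd multiple of 2^(K+3).
odd-square-roots-mod-2^ : ∀ e K → ∃ λ y → Odd y × 2^ (3 ℕ.+ K) ∣ˢ y * y - (+ 8 * e + + 1)
odd-square-roots-mod-2^ e zero = + 1 , (+ 0 , refl) , divides (- e) (identity e)
  where
  identity : ∀ e → + 1 * + 1 - (+ 8 * e + + 1) ≡ - e * + 8
  identity = solve-∀
odd-square-roots-mod-2^ e (suc K) with odd-square-roots-mod-2^ e K
... | y , oy , d with 2^-lift (3 ℕ.+ K) (odd-+-2^suc oy K) d
...   | inj₁ d′ = y , oy , d′
...   | inj₂ d′ = y + 2^ (2 ℕ.+ K) , odd-+-2^suc oy (suc K) , subst (2^ (3 ℕ.+ suc K) ∣ˢ_) (sym square-shift) d′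
  where
  open ≡-Reasoning
  Δ = + 8 * e + + 1
  R = 2^ suc K
  identity : ∀ y R Δ → (y + + 2 * R) * (y + + 2 * R) - Δ ≡ y * y - Δ + + 2 * (+ 2 * R) * (y + R)
  identity = solve-∀
  square-shift : (y + 2^ (2 ℕ.+ K)) * (y + 2^ (2 ℕ.+ K)) - Δ ≡ y * y - Δ + 2^ (3 ℕ.+ K) * (y + R)
  square-shift = begin
    (y + 2^ (2 ℕ.+ K)) * (y + 2^ (2 ℕ.+ K)) - Δ  ≡⟨ cong (λ Q → (y + Q) * (y + Q) - Δ) (2^-suc (suc K)) ⟩
    (y + + 2 * R) * (y + + 2 * R) - Δ            ≡⟨ identity y R Δ ⟩
    y * y - Δ + + 2 * (+ 2 * R) * (y + R)        ≡⟨ cong (λ Q → y * y - Δ + Q * (y + R)) (sym 2^[3+K]≡) ⟩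
    y * y - Δ + 2^ (3 ℕ.+ K) * (y + R)           ∎
    where
    2^[3+K]≡ : 2^ (3 ℕ.+ K) ≡ + 2 * (+ 2 * R)
    2^[3+K]≡ = trans (2^-suc (2 ℕ.+ K)) (cong (+ 2 *_) (2^-suc (suc K)))

quad-odd : ∀ a b c → Even (a + b) → Odd c → ∀ n → Odd (quad a b c n)
quad-odd a b c (σ , a+b≡) (γ , refl) n with even-pronic (+ n)
... | p , n[n+1]≡ = a * p + σ * N - a * N + γ , (begin
  quad a b c n                                              ≡⟨ regroup a b c N ⟩
  a * (N * (N + + 1)) + (a + b) * N - + 2 * a * N + c       ≡⟨ cong₂ (λ P S → a * P + S * N - + 2 * a * N + c) n[n+1]≡ a+b≡ ⟩
  a * (+ 2 * p) + + 2 * σ * N - + 2 * a * N + c             ≡⟨ halve a p σ N γ ⟩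
  + 2 * (a * p + σ * N - a * N + γ) + + 1                   ∎)
  where
  open ≡-Reasoning
  N = + n
  regroup : ∀ a b c N → a * (N * N) + b * N + c ≡ a * (N * (N + + 1)) + (a + b) * N - + 2 * a * N + c
  regroup = solve-∀
  halve : ∀ a p σ N γ → a * (+ 2 * p) + + 2 * σ * N - + 2 * a * N + (+ 2 * γ + + 1) ≡ + 2 * (a * p + σ * N - a * N + γ) + + 1
  halve = solve-∀

quad-even-value : ∀ a b c → Odd b → Even a ⊎ Even c → ∃ λ n₀ → + 2 ∣ˢ quad a b c n₀
quad-even-value a b c ob ea⊎ec with parity c
... | inj₁ (γ , c≡) = 0 , even⇒2∣ (γ , trans (at-0 a b c) c≡)
  where
  at-0 : ∀ a b c → a * (+ 0 * + 0) + b * + 0 + c ≡ c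
  at-0 = solve-∀
... | inj₂ oc with ea⊎ec | ob | oc
...   | inj₂ ec         | _         | _         = ⊥-elim (odd⇒2∤ oc (even⇒2∣ ec))
...   | inj₁ (α , refl) | (β , refl) | (γ , refl) = 1 , even⇒2∣ (α + β + γ + + 1 , at-1 α β γ)
  where
  at-1 : ∀ α β γ → + 2 * α * (+ 1 * + 1) + (+ 2 * β + + 1) * + 1 + (+ 2 * γ + + 1) ≡ + 2 * (α + β + γ + + 1)
  at-1 = solve-∀

quad-unbounded-odd-b : ∀ a b c → Odd b → (∃ λ n₀ → + 2 ∣ˢ quad a b c n₀) → Unbounded (λ n → ν₂ (quad a b c n))
quad-unbounded-odd-b a b c ob (n₀ , d) = unbounded (quad a b c) (quad-roots-mod-2^ a b c n₀ ob d)

quad-complete-square : ∀ a β c n → a * quad a (+ 2 * β) c n ≡ (a * + n + β) * (a * + n + β) - (β * β - a * c)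
quad-complete-square a β c n = identity a β c (+ n)
  where
  identity : ∀ a β c N → a * (a * (N * N) + + 2 * β * N + c) ≡ (a * N + β) * (a * N + β) - (β * β - a * c)
  identity = solve-∀

disc-even-b : ∀ a β c → (+ 2 * β) * (+ 2 * β) - + 4 * a * c ≡ + 4 * (β * β - a * c)
disc-even-b = solve-∀

quarter-disc : ∀ a β c m Δ → (+ 2 * β) * (+ 2 * β) - + 4 * a * c ≡ + (4 ℕ.^ suc m) * Δ → β * β - a * c ≡ + (4 ℕ.^ m) * Δ
quarter-disc a β c m Δ D≡ = ℤP.*-cancelˡ-≡ (+ 4) _ _ (begin
  + 4 * (β * β - a * c)                   ≡⟨ sym (disc-even-b a β c) ⟩
  (+ 2 * β) * (+ 2 * β) - + 4 * a * c     ≡⟨ D≡ ⟩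
  + (4 ℕ.* 4 ℕ.^ m) * Δ                   ≡⟨ cong (_* Δ) (ℤP.pos-* 4 (4 ℕ.^ m)) ⟩
  + 4 * + (4 ℕ.^ m) * Δ                   ≡⟨ ℤP.*-assoc (+ 4) (+ (4 ℕ.^ m)) Δ ⟩
  + 4 * (+ (4 ℕ.^ m) * Δ)                 ∎)
  where open ≡-Reasoning

unbounded-if-square-mod-2^ : ∀ a β c → Odd a → (∀ K → ∃ λ w → 2^ K ∣ˢ w * w - (β * β - a * c)) →
  Unbounded (λ n → ν₂ (quad a (+ 2 * β) c n))
unbounded-if-square-mod-2^ a β c oa square-root = unbounded (quad a (+ 2 * β) c) roots
  where
  difference-of-squares : ∀ x w r D → (x + r) * (x + r) - D ≡ w * w - D + (x + (r - w)) * (x + r + w)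
  difference-of-squares = solve-∀
  roots : ∀ K → ∃ λ n → 2^ K ∣ˢ quad a (+ 2 * β) c n
  roots K with square-root K
  ... | w , 2^∣w²-D with linear-roots-mod-2^ a (β - w) oa K
  ...   | n , 2^∣x-w = n , 2^∣-cancel-odd oa K (subst (2^ K ∣ˢ_)
          (sym (trans (quad-complete-square a β c n) (difference-of-squares (a * + n) w β (β * β - a * c))))
          (∣m∣n⇒∣m+n 2^∣w²-D (∣m⇒∣m*n _ 2^∣x-w)))

quad-unbounded-D≡0 : ∀ a b c → Odd a → Even b → b * b - + 4 * a * c ≡ + 0 → Unbounded (λ n → ν₂ (quad a b c n))
quad-unbounded-D≡0 a b c oa (β , refl) D≡0 = unbounded-if-square-mod-2^ a β c oa
  (λ K → + 0 , subst (λ D′ → 2^ K ∣ˢ + 0 - D′) (sym D′≡0) (divides (+ 0) refl))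
  where
  D′≡0 : β * β - a * c ≡ + 0
  D′≡0 = ℤP.*-cancelˡ-≡ (+ 4) _ (+ 0) (trans (sym (disc-even-b a β c)) D≡0)

div-mod-8 : ∀ Δ {r} → Δ % + 8 ≡ r → Δ ≡ + 8 * (Δ / + 8) + + r
div-mod-8 Δ refl = trans (a≡a%n+[a/n]*n Δ (+ 8)) (swap (+ (Δ % + 8)) (Δ / + 8))
  where
  swap : ∀ r q → r + q * + 8 ≡ + 8 * q + r
  swap = solve-∀

quad-unbounded-Δ≡1-mod-8 : ∀ a b c {ℓ Δ} → Odd a → Even b → 1 ℕ.≤ ℓ → b * b - + 4 * a * c ≡ + (4 ℕ.^ ℓ) * Δ →
  Δ % + 8 ≡ 1 → Unbounded (λ n → ν₂ (quad a b c n))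
quad-unbounded-Δ≡1-mod-8 a b c {suc m} {Δ} oa (β , refl) _ D≡ Δ%8≡1 = unbounded-if-square-mod-2^ a β c oa square-root
  where
  square-root : ∀ K → ∃ λ w → 2^ K ∣ˢ w * w - (β * β - a * c)
  square-root K with odd-square-roots-mod-2^ (Δ / + 8) K
  ... | y , _ , 2^∣y²-Δ = 2^ m * y , subst (2^ K ∣ˢ_) (sym scale)
        (∣n⇒∣m*n (2^ m * 2^ m) (∣-trans (2^-∣-2^ (ℕP.m≤n+m K 3)) 2^∣y²-Δ))
    where
    open ≡-Reasoning
    scale-identity : ∀ M y D → (M * y) * (M * y) - M * M * D ≡ M * M * (y * y - D)
    scale-identity = solve-∀
    scale : (2^ m * y) * (2^ m * y) - (β * β - a * c) ≡ 2^ m * 2^ m * (y * y - (+ 8 * (Δ / + 8) + + 1))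
    scale = begin
      (2^ m * y) * (2^ m * y) - (β * β - a * c)          ≡⟨ cong (λ D → (2^ m * y) * (2^ m * y) - D) (quarter-disc a β c m Δ D≡) ⟩
      (2^ m * y) * (2^ m * y) - + (4 ℕ.^ m) * Δ          ≡⟨ cong₂ (λ F D → (2^ m * y) * (2^ m * y) - F * D) (4^≡2^*2^ m) (div-mod-8 Δ Δ%8≡1) ⟩
      (2^ m * y) * (2^ m * y) - 2^ m * 2^ m * (+ 8 * (Δ / + 8) + + 1)  ≡⟨ scale-identity (2^ m) y _ ⟩
      2^ m * 2^ m * (y * y - (+ 8 * (Δ / + 8) + + 1))    ∎

-- The bounded case, where a·f(n) = G m Δ (an + β)

G : ℕ → ℤ → ℤ → ℤ
G m Δ x = x * x - + (4 ℕ.^ m) * Δ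

G-double : ∀ m Δ x → G (suc m) Δ (+ 2 * x) ≡ + 2 * (+ 2 * G m Δ x)
G-double m Δ x = trans (cong (λ F → (+ 2 * x) * (+ 2 * x) - F * Δ) (ℤP.pos-* 4 (4 ℕ.^ m))) (identity x (+ (4 ℕ.^ m)) Δ)
  where
  identity : ∀ x F Δ → (+ 2 * x) * (+ 2 * x) - + 4 * F * Δ ≡ + 2 * (+ 2 * (x * x - F * Δ))
  identity = solve-∀

G-odd : ∀ m Δ k → Odd (G (suc m) Δ (+ 2 * k + + 1))
G-odd m Δ k = + 2 * k * k + + 2 * k - + 2 * F * Δ ,
  trans (cong (λ F′ → (+ 2 * k + + 1) * (+ 2 * k + + 1) - F′ * Δ) (ℤP.pos-* 4 (4 ℕ.^ m))) (identity k F Δ)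
  where
  F = + (4 ℕ.^ m)
  identity : ∀ k F Δ → (+ 2 * k + + 1) * (+ 2 * k + + 1) - + 4 * F * Δ ≡ + 2 * (+ 2 * k * k + + 2 * k - + 2 * F * Δ) + + 1
  identity = solve-∀

∥-G-double : ∀ m Δ x {v} → 2^ v ∥ G m Δ x → 2^ (2 ℕ.+ v) ∥ G (suc m) Δ (+ 2 * x)
∥-G-double m Δ x {v} h = subst (2^ (2 ℕ.+ v) ∥_) (sym (G-double m Δ x)) (∥-2* (∥-2* h))

shift-even : ∀ n k t → + 2 * k + 2^ suc n * t ≡ + 2 * (k + 2^ n * t)
shift-even n k t = trans (cong (λ P → + 2 * k + P * t) (2^-suc n)) (identity k (2^ n) t)
  where
  identity : ∀ k P t → + 2 * k + + 2 * P * t ≡ + 2 * (k + P * t)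
  identity = solve-∀

shift-odd : ∀ n k t → + 2 * k + + 1 + 2^ suc n * t ≡ + 2 * (k + 2^ n * t) + + 1
shift-odd n k t = trans (cong (λ P → + 2 * k + + 1 + P * t) (2^-suc n)) (identity k (2^ n) t)
  where
  identity : ∀ k P t → + 2 * k + + 1 + + 2 * P * t ≡ + 2 * (k + P * t) + + 1
  identity = solve-∀

record ParityValuations (Δ : ℤ) : Set where
  field
    vₑ vₒ     : ℕ
    vₑ≤2      : vₑ ℕ.≤ 2
    vₒ≤2      : vₒ ℕ.≤ 2
    vₑ≢vₒ     : vₑ ≢ vₒ
    ∥-at-even : ∀ k → 2^ vₑ ∥ G 0 Δ (+ 2 * k)
    ∥-at-odd  : ∀ k → 2^ vₒ ∥ G 0 Δ (+ 2 * k + + 1)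

-- For even x, x² − Δ ≡ −Δ (mod 4); for odd x, x² − Δ ≡ 1 − Δ (mod 8).
parity-valuations : ∀ {Δ r} → Δ % + 8 ≡ r → ∀ vₑ vₒ → vₑ ℕ.< 2 → vₒ ℕ.< 3 → vₑ ≢ vₒ →
  2^ vₑ ∥ - + r → 2^ vₒ ∥ + 1 - + r → ParityValuations Δ
parity-valuations {Δ} {r} Δ%8≡r vₑ vₒ vₑ<2 vₒ<3 vₑ≢vₒ ∥-r ∥1-r = subst ParityValuations (sym (div-mod-8 Δ Δ%8≡r)) (record
  { vₑ = vₑ ; vₒ = vₒ
  ; vₑ≤2 = ℕP.m≤n⇒m≤1+n (ℕP.≤-pred vₑ<2)
  ; vₒ≤2 = ℕP.≤-pred vₒ<3
  ; vₑ≢vₒ = vₑ≢vₒ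
  ; ∥-at-even = λ k → subst (2^ vₑ ∥_) (sym (even-case k e (+ r))) (∥-+-2^* (k * k - + 2 * e) vₑ<2 ∥-r)
  ; ∥-at-odd = λ k → let T , square≡ = odd-square k in
      subst (2^ vₒ ∥_) (sym (trans (cong (_- + 1 * (+ 8 * e + + r)) square≡) (odd-case T e (+ r))))
        (∥-+-2^* (T - e) vₒ<3 ∥1-r)
  })
  where
  e = Δ / + 8
  even-case : ∀ k e R → (+ 2 * k) * (+ 2 * k) - + 1 * (+ 8 * e + R) ≡ - R + + 4 * (k * k - + 2 * e)
  even-case = solve-∀
  odd-case : ∀ T e R → + 1 + + 8 * T - + 1 * (+ 8 * e + R) ≡ + 1 - R + + 8 * (T - e)
  odd-case = solve-∀

parity-valuations-mod-8 : ∀ Δ → (Δ % + 8 ≡ 2 ⊎ Δ % + 8 ≡ 3 ⊎ Δ % + 8 ≡ 5 ⊎ Δ % + 8 ≡ 6 ⊎ Δ % + 8 ≡ 7) →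
  ParityValuations Δ
parity-valuations-mod-8 Δ (inj₁ ≡2) =
  parity-valuations ≡2 1 0 (s≤s (s≤s z≤n)) (s≤s z≤n) (λ ()) (∥-intro (- + 1) refl) (∥-intro (- + 1) refl)
parity-valuations-mod-8 Δ (inj₂ (inj₁ ≡3)) =
  parity-valuations ≡3 0 1 (s≤s z≤n) (s≤s (s≤s z≤n)) (λ ()) (∥-intro (- + 2) refl) (∥-intro (- + 1) refl)
parity-valuations-mod-8 Δ (inj₂ (inj₂ (inj₁ ≡5))) =
  parity-valuations ≡5 0 2 (s≤s z≤n) (s≤s (s≤s (s≤s z≤n))) (λ ()) (∥-intro (- + 3) refl) (∥-intro (- + 1) refl)
parity-valuations-mod-8 Δ (inj₂ (inj₂ (inj₂ (inj₁ ≡6)))) =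
  parity-valuations ≡6 1 0 (s≤s (s≤s z≤n)) (s≤s z≤n) (λ ()) (∥-intro (- + 2) refl) (∥-intro (- + 3) refl)
parity-valuations-mod-8 Δ (inj₂ (inj₂ (inj₂ (inj₂ ≡7)))) =
  parity-valuations ≡7 0 1 (s≤s z≤n) (s≤s (s≤s z≤n)) (λ ()) (∥-intro (- + 4) refl) (∥-intro (- + 2) refl)

x+y*0≡x : ∀ x y → x + y * + 0 ≡ x
x+y*0≡x x y = trans (cong (_+_ x) (ℤP.*-zeroʳ y)) (ℤP.+-identityʳ x)

module _ {Δ : ℤ} (pv : ParityValuations Δ) where
  open ParityValuations pv

  G-valuation : ∀ m x → ∃ λ v → v ℕ.≤ 2 ℕ.+ 2 ℕ.* m × (∀ t → 2^ v ∥ G m Δ (x + 2^ suc m * t))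
  G-valuation zero x with parity x
  ... | inj₁ (k , refl) = vₑ , vₑ≤2 , λ t →
        subst (λ x′ → 2^ vₑ ∥ G 0 Δ x′) (sym (shift-even 0 k t)) (∥-at-even (k + 2^ 0 * t))
  ... | inj₂ (k , refl) = vₒ , vₒ≤2 , λ t →
        subst (λ x′ → 2^ vₒ ∥ G 0 Δ x′) (sym (shift-odd 0 k t)) (∥-at-odd (k + 2^ 0 * t))
  G-valuation (suc m) x with parity x
  ... | inj₂ (k , refl) = 0 , z≤n , λ t →
        subst (λ x′ → 2^ 0 ∥ G (suc m) Δ x′) (sym (shift-odd (suc m) k t)) (odd⇒2^0∥ (G-odd m Δ (k + 2^ suc m * t)))
  ... | inj₁ (k , refl) with G-valuation m k
  ...   | v , v≤ , h = 2 ℕ.+ v , bound , λ t →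
        subst (λ x′ → 2^ (2 ℕ.+ v) ∥ G (suc m) Δ x′) (sym (shift-even (suc m) k t)) (∥-G-double m Δ (k + 2^ suc m * t) (h t))
    where
    bound : 2 ℕ.+ v ℕ.≤ 2 ℕ.+ 2 ℕ.* suc m
    bound = subst (2 ℕ.+ v ℕ.≤_) (cong (2 ℕ.+_) (sym (ℕP.*-suc 2 m))) (ℕP.+-monoʳ-≤ 2 v≤)

  G-∥ : ∀ m x → ∃ λ v → v ℕ.≤ 2 ℕ.+ 2 ℕ.* m × 2^ v ∥ G m Δ x
  G-∥ m x = let v , v≤ , h = G-valuation m x in
    v , v≤ , subst (λ x′ → 2^ v ∥ G m Δ x′) (x+y*0≡x x (2^ suc m)) (h (+ 0))

  -- At level m + 1, odd x give valuation 0 while G (m+1) Δ 0 = 4·G m Δ 0 has valuation ≥ 2;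
  -- even x reduce to level m.
  G-zero-class : ∀ m {V} x → 2^ V ∥ G m Δ (+ 0) → 2^ V ∥ G m Δ x → 2^ suc m ∣ˢ x
  G-zero-class zero x h₀ hx with parity x
  ... | inj₁ even = even⇒2∣ even
  ... | inj₂ (k , refl) = ⊥-elim (vₑ≢vₒ (trans (∥-unique (∥-at-even (+ 0)) h₀) (∥-unique hx (∥-at-odd k))))
  G-zero-class (suc m) x h₀ hx with parity x | G-∥ m (+ 0)
  ... | inj₂ (k , refl) | v , _ , hv =
        ⊥-elim (ℕP.0≢1+n (trans (∥-unique (odd⇒2^0∥ (G-odd m Δ k)) hx) (sym (∥-unique (∥-G-double m Δ (+ 0) hv) h₀))))
  ... | inj₁ (k , refl) | v , _ , hv with G-∥ m k
  ...   | w , _ , hw = 2^∣⇒2^suc∣2* (suc m) (G-zero-class m k hv (subst (λ u → 2^ u ∥ G m Δ k) w≡v hw))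
    where
    w≡v : w ≡ v
    w≡v = ℕP.+-cancelˡ-≡ 2 w v (trans (∥-unique (∥-G-double m Δ k hw) hx) (sym (∥-unique (∥-G-double m Δ (+ 0) hv) h₀)))

module _ (a β c : ℤ) (m : ℕ) (Δ : ℤ) (oa : Odd a) (D′≡ : β * β - a * c ≡ + (4 ℕ.^ m) * Δ) (pv : ParityValuations Δ) where
  private
    s : ℕ → ℕ∞
    s n = ν₂ (quad a (+ 2 * β) c n)
    X : ℕ → ℤ
    X n = a * + n + β

  ν₂-quad : ∀ n {v} → 2^ v ∥ G m Δ (X n) → s n ≡ fin v
  ν₂-quad n {v} h = ν₂-≡ (∥-cancel-odd oa (subst (2^ v ∥_)
    (sym (trans (quad-complete-square a β c n) (cong (_-_ (X n * X n)) D′≡))) h))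

  X-shift : ∀ n p → X (n ℕ.+ p) ≡ X n + + p * a
  X-shift n p = trans (cong (λ N → a * N + β) (ℤP.pos-+ n p)) (identity a (+ n) (+ p) β)
    where
    identity : ∀ a N P β → a * (N + P) + β ≡ a * N + β + P * a
    identity = solve-∀

  quad-valuation-bounded : Bounded s
  quad-valuation-bounded = 2 ℕ.+ 2 ℕ.* m , λ n → let v , v≤ , h = G-∥ pv m (X n) in
    subst (_≤∞ fin (2 ℕ.+ 2 ℕ.* m)) (sym (ν₂-quad n h)) (fin≤fin v≤)

  quad-valuation-period : ∀ n → s (n ℕ.+ 2 ℕ.^ suc m) ≡ s n
  quad-valuation-period n = let v , _ , h = G-valuation pv m (X n) in
    trans (ν₂-quad (n ℕ.+ 2 ℕ.^ suc m) (subst (λ x → 2^ v ∥ G m Δ x) (sym (X-shift n (2 ℕ.^ suc m))) (h a)))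
          (sym (ν₂-quad n (subst (λ x → 2^ v ∥ G m Δ x) (x+y*0≡x (X n) (2^ suc m)) (h (+ 0)))))

  -- Choose n₀ with a n₀ + β ≡ 0 (mod 2^(m+1)); a period q preserves the valuation at n₀ + q,
  -- so a q ≡ 0 (mod 2^(m+1)) by G-zero-class.
  quad-valuation-period-minimal : ∀ q → IsPeriod s q → 2 ℕ.^ suc m ℕ.≤ q
  quad-valuation-period-minimal q (q>0 , q-period) with linear-roots-mod-2^ a β oa (suc m) | G-valuation pv m (+ 0)
  ... | n₀ , divides t X≡ | V , _ , h₀ with G-∥ pv m (X (n₀ ℕ.+ q))
  ...   | w , _ , hw = ℕD.∣⇒≤ {{ℕ.>-nonZero q>0}} (∣⇒∣ᵤ (2^∣-cancel-odd oa (suc m) 2^∣aq))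
    where
    hV₀ : 2^ V ∥ G m Δ (+ 0)
    hV₀ = subst (λ x → 2^ V ∥ G m Δ x) (x+y*0≡x (+ 0) (2^ suc m)) (h₀ (+ 0))
    s-n₀ : s n₀ ≡ fin V
    s-n₀ = ν₂-quad n₀ (subst (λ x → 2^ V ∥ G m Δ x) (trans (ℤP.+-identityˡ _) (sym (trans X≡ (ℤP.*-comm t (2^ suc m))))) (h₀ t))
    w≡V : w ≡ V
    w≡V = fin-injective (trans (sym (ν₂-quad (n₀ ℕ.+ q) hw)) (trans (q-period n₀) s-n₀))
    2^∣X : 2^ suc m ∣ˢ X n₀ + + q * a
    2^∣X = subst (2^ suc m ∣ˢ_) (X-shift n₀ q) (G-zero-class pv m _ hV₀ (subst (λ u → 2^ u ∥ _) w≡V hw))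
    2^∣aq : 2^ suc m ∣ˢ a * + q
    2^∣aq = subst (2^ suc m ∣ˢ_) (ℤP.*-comm (+ q) a) (∣m+n∣m⇒∣n 2^∣X (divides t X≡))

  quad-valuation-minimal-period : MinimalPeriod s (2 ℕ.^ suc m)
  quad-valuation-minimal-period = (ℕP.m^n>0 2 (suc m) , quad-valuation-period) , quad-valuation-period-minimal

quad-bounded-periodic : ∀ a b c {ℓ Δ} → Odd a → Even b → 1 ℕ.≤ ℓ → b * b - + 4 * a * c ≡ + (4 ℕ.^ ℓ) * Δ →
  (Δ % + 8 ≡ 2 ⊎ Δ % + 8 ≡ 3 ⊎ Δ % + 8 ≡ 5 ⊎ Δ % + 8 ≡ 6 ⊎ Δ % + 8 ≡ 7) →
  Bounded (λ n → ν₂ (quad a b c n)) × MinimalPeriod (λ n → ν₂ (quad a b c n)) (2 ℕ.^ ℓ)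
quad-bounded-periodic a b c {suc m} {Δ} oa (β , refl) _ D≡ Δ%8 =
  quad-valuation-bounded a β c m Δ oa D′≡ pv , quad-valuation-minimal-period a β c m Δ oa D′≡ pv
  where
  D′≡ = quarter-disc a β c m Δ D≡
  pv = parity-valuations-mod-8 Δ Δ%8

theorem1 : (a b c : ℤ) → a ≢ + 0 → ¬ ((+ 2 ∣ a) × (+ 2 ∣ b) × (+ 2 ∣ c)) →
    let s = λ n → ν₂ (quad a b c n)
        D = b ℤ.* b ℤ.- + 4 ℤ.* a ℤ.* c
    in ((+ 2 ∣ a) → (+ 2 ∣ b) → ¬ (+ 2 ∣ c) → ∀ n → s n ≡ fin 0)
     × ((+ 2 ∣ a) → ¬ (+ 2 ∣ b) → Unbounded s)
     × (¬ (+ 2 ∣ a) → (+ 2 ∣ b) → D ≡ + 0 → Unbounded s)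
     × (¬ (+ 2 ∣ a) → (+ 2 ∣ b) → (ℓ : ℕ) → (Δ : ℤ) → 1 ℕ.≤ ℓ →
          D ≡ + (4 ℕ.^ ℓ) ℤ.* Δ → (∀ k → 1 ℕ.≤ k → + (4 ℕ.^ k) ∣ D → k ℕ.≤ ℓ) →
          Δ % + 8 ≡ 1 → Unbounded s)
     × (¬ (+ 2 ∣ a) → (+ 2 ∣ b) → (ℓ : ℕ) → (Δ : ℤ) → 1 ℕ.≤ ℓ →
          D ≡ + (4 ℕ.^ ℓ) ℤ.* Δ → (∀ k → 1 ℕ.≤ k → + (4 ℕ.^ k) ∣ D → k ℕ.≤ ℓ) →
          (Δ % + 8 ≡ 2 ⊎ Δ % + 8 ≡ 3 ⊎ Δ % + 8 ≡ 5 ⊎ Δ % + 8 ≡ 6 ⊎ Δ % + 8 ≡ 7) →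
          Bounded s × MinimalPeriod s (2 ℕ.^ ℓ))
     × (¬ (+ 2 ∣ a) → ¬ (+ 2 ∣ b) → (+ 2 ∣ c) → Unbounded s)
     × (¬ (+ 2 ∣ a) → ¬ (+ 2 ∣ b) → ¬ (+ 2 ∣ c) → ∀ n → s n ≡ fin 0)
theorem1 a b c _ _ =
    (λ 2∣a 2∣b 2∤c n → ν₂-≡ (odd⇒2^0∥ (quad-odd a b c (even-+-even (2∣⇒even a 2∣a) (2∣⇒even b 2∣b)) (2∤⇒odd c 2∤c) n)))
  , (λ 2∣a 2∤b → quad-unbounded-odd-b a b c (2∤⇒odd b 2∤b) (quad-even-value a b c (2∤⇒odd b 2∤b) (inj₁ (2∣⇒even a 2∣a))))
  , (λ 2∤a 2∣b → quad-unbounded-D≡0 a b c (2∤⇒odd a 2∤a) (2∣⇒even b 2∣b))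
  , (λ 2∤a 2∣b ℓ Δ 1≤ℓ D≡ _ → quad-unbounded-Δ≡1-mod-8 a b c (2∤⇒odd a 2∤a) (2∣⇒even b 2∣b) 1≤ℓ D≡)
  , (λ 2∤a 2∣b ℓ Δ 1≤ℓ D≡ _ → quad-bounded-periodic a b c (2∤⇒odd a 2∤a) (2∣⇒even b 2∣b) 1≤ℓ D≡)
  , (λ 2∤a 2∤b 2∣c → quad-unbounded-odd-b a b c (2∤⇒odd b 2∤b) (quad-even-value a b c (2∤⇒odd b 2∤b) (inj₂ (2∣⇒even c 2∣c))))
  , (λ 2∤a 2∤b 2∤c n → ν₂-≡ (odd⇒2^0∥ (quad-odd a b c (odd-+-odd (2∤⇒odd a 2∤a) (2∤⇒odd b 2∤b)) (2∤⇒odd c 2∤c) n)))
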